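{- Fix a port-labeled anonymous graph $G$ and a starting node $r$. For any deterministic treasure hunt algorithm $\mathcal{A}$ and any integer $t\ge 1$, the number of distinct sequences of port numbers $p_1,p_2,\ldots,p_t$ that the agent executing $\mathcal{A}$ from $r$ can follow during its first $t$ moves, taken over all possible placements of pebbles on the nodes of $G$ (at most one pebble per node), is at most $2^t$.
   Context: Model: nodes of $G$ are anonymous; at each node $v$ the incident edges carry distinct port numbers $0,\ldots,\deg(v)-1$. The agent starts at $r$ knowing only $\deg(r)$; at each step it deterministically chooses a port at its current node and traverses that edge; upon arriving at a node it learns that node's degree, the port through which it arrived, and whether a pebble lies on that node. Pebbles are placed beforehand by an oracle, at most one per node. The sequence of port numbers followed is the sequence of ports chosen by the agent at each move. -}

module Defs where

open import Data.Nat using (ℕ; zero; suc)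
open import Data.Fin using (Fin; toℕ)
open import Data.Bool using (Bool)
open import Data.List using (List; []; _∷_)
open import Data.Vec using (Vec; []; _∷_)
open import Data.Product using (Σ; _,_; proj₁; proj₂)
open import Relation.Binary.PropositionalEquality using (_≡_; refl; subst)

-- The degree of node v is
-- suc (dm1 v) (every node has degree ≥ 1).  The edge leaving
-- v through port p arrives at node proj₁ (port v p) through port
-- proj₂ (port v p).
record PortGraph (n : ℕ) : Set where
  field
    dm1  : Fin n → ℕ
    port : (v : Fin n) → Fin (suc (dm1 v)) → Σ (Fin n) (λ w → Fin (suc (dm1 w)))
    port-sym : ∀ v p w q → port v p ≡ (w , q) → port w q ≡ (v , p)

-- What the agent learns upon arriving at a node.
record Obs : Set where
  constructor obs
  field
    degm1   : ℕ
    inPort  : ℕ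
    pebble  : Bool

-- Knowledge of the agent: deg r (minus one) and the list of observations,
-- most recent first.  Degree (minus one) of the current node:
curDm1 : ℕ → List Obs → ℕ
curDm1 d0 []      = d0
curDm1 d0 (o ∷ _) = Obs.degm1 o

Algorithm : Set
Algorithm = (d0 : ℕ) → (hs : List Obs) → Fin (suc (curDm1 d0 hs))

-- Pebble placement: at most one pebble per node.
Placement : ℕ → Set
Placement n = Fin n → Bool

module Run {n : ℕ} (G : PortGraph n) (A : Algorithm) (r : Fin n) (P : Placement n) where
  open PortGraph G

  go : (k : ℕ) → (v : Fin n) → (hs : List Obs) → curDm1 (dm1 r) hs ≡ dm1 v → Vec ℕ k
  go zero    v hs eq = []
  go (suc k) v hs eq =
    let p  = subst (λ d → Fin (suc d)) eq (A (dm1 r) hs)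
        wq = port v p
        w  = proj₁ wq
        q  = proj₂ wq
    in toℕ p ∷ go k w (obs (dm1 w) (toℕ q) (P w) ∷ hs) refl

portSeq : {n : ℕ} → PortGraph n → Algorithm → Fin n → Placement n → (t : ℕ) → Vec ℕ t
portSeq G A r P t = Run.go G A r P t r [] refl

{-# OPTIONS --safe #-}
-- Apart from the fixed graph, algorithm and start, the only input the agent
-- receives is one pebble bit per move.  Hence the port sequence of the first
-- t moves is a function of a bit string of length t, and there are only 2^t
-- such strings.
module Submission where

open import Defs
open import Data.Nat using (ℕ; _≤_; _^_; zero; suc; _+_)
open import Data.Nat.Properties using (≤-reflexive; +-identityʳ)
open import Data.Fin using (Fin; toℕ)
open import Data.Bool using (Bool; true; false)
open import Data.Vec using (Vec; []; _∷_)
open import Data.List using (List; length; []; _∷_; _++_; map)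
open import Data.List.Properties using (length-map; length-++)
open import Data.List.Membership.Propositional using (_∈_)
open import Data.List.Membership.Propositional.Properties using (∈-map⁺; ∈-++⁺ˡ; ∈-++⁺ʳ)
open import Data.List.Relation.Unary.Any using (here)
open import Data.Product using (Σ; _×_; _,_; proj₁; proj₂)
open import Relation.Binary.PropositionalEquality using (_≡_; refl; sym; subst; cong; cong₂; module ≡-Reasoning)

bitStrings : (k : ℕ) → List (Vec Bool k)
bitStrings zero    = [] ∷ []
bitStrings (suc k) = map (true ∷_) (bitStrings k) ++ map (false ∷_) (bitStrings k)

length-bitStrings : (k : ℕ) → length (bitStrings k) ≡ 2 ^ k
length-bitStrings zero    = refl
length-bitStrings (suc k) = begin
  length (map (true ∷_) bs ++ map (false ∷_) bs)          ≡⟨ length-++ (map (true ∷_) bs) ⟩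
  length (map (true ∷_) bs) + length (map (false ∷_) bs) ≡⟨ cong₂ _+_ (length-map _ bs) (length-map _ bs) ⟩
  length bs + length bs                                   ≡⟨ cong₂ _+_ (length-bitStrings k) (length-bitStrings k) ⟩
  2 ^ k + 2 ^ k                                           ≡⟨ cong (2 ^ k +_) (+-identityʳ (2 ^ k)) ⟨
  2 ^ suc k                                               ∎
  where
    open ≡-Reasoning
    bs = bitStrings k

∈-bitStrings : {k : ℕ} (bs : Vec Bool k) → bs ∈ bitStrings k
∈-bitStrings []           = here refl
∈-bitStrings (true  ∷ bs) = ∈-++⁺ˡ (∈-map⁺ (true ∷_) (∈-bitStrings bs))
∈-bitStrings {suc k} (false ∷ bs) =
  ∈-++⁺ʳ (map (true ∷_) (bitStrings k)) (∈-map⁺ (false ∷_) (∈-bitStrings bs))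

module BitDriven {n : ℕ} (G : PortGraph n) (A : Algorithm) (r : Fin n) where
  open PortGraph G

  -- The run of Run.go, with the pebble bit observed at each arrival read off
  -- the given string instead of a placement.
  portsDrivenBy : (k : ℕ) (v : Fin n) (hs : List Obs) → curDm1 (dm1 r) hs ≡ dm1 v →
                  Vec Bool k → Vec ℕ k
  portsDrivenBy zero    v hs eq []       = []
  portsDrivenBy (suc k) v hs eq (b ∷ bs) =
    let p = subst (λ d → Fin (suc d)) eq (A (dm1 r) hs)
        w = proj₁ (port v p)
        q = proj₂ (port v p)
    in toℕ p ∷ portsDrivenBy k w (obs (dm1 w) (toℕ q) b ∷ hs) refl bs

  pebblesSeen : Placement n → (k : ℕ) (v : Fin n) (hs : List Obs) →
                curDm1 (dm1 r) hs ≡ dm1 v → Vec Bool k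
  pebblesSeen P zero    v hs eq = []
  pebblesSeen P (suc k) v hs eq =
    let p = subst (λ d → Fin (suc d)) eq (A (dm1 r) hs)
        w = proj₁ (port v p)
        q = proj₂ (port v p)
    in P w ∷ pebblesSeen P k w (obs (dm1 w) (toℕ q) (P w) ∷ hs) refl

  go≡portsDrivenBy-pebblesSeen : (P : Placement n) (k : ℕ) (v : Fin n) (hs : List Obs)
    (eq : curDm1 (dm1 r) hs ≡ dm1 v) →
    Run.go G A r P k v hs eq ≡ portsDrivenBy k v hs eq (pebblesSeen P k v hs eq)
  go≡portsDrivenBy-pebblesSeen P zero    v hs eq = refl
  go≡portsDrivenBy-pebblesSeen P (suc k) v hs eq =
    cong (_ ∷_) (go≡portsDrivenBy-pebblesSeen P k _ _ refl)

  portSeqs : (t : ℕ) → List (Vec ℕ t)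
  portSeqs t = map (portsDrivenBy t r [] refl) (bitStrings t)

  length-portSeqs : (t : ℕ) → length (portSeqs t) ≡ 2 ^ t
  length-portSeqs t = begin
    length (portSeqs t)    ≡⟨ length-map _ (bitStrings t) ⟩
    length (bitStrings t)  ≡⟨ length-bitStrings t ⟩
    2 ^ t                  ∎
    where open ≡-Reasoning

  portSeq∈portSeqs : (P : Placement n) (t : ℕ) → portSeq G A r P t ∈ portSeqs t
  portSeq∈portSeqs P t =
    subst (_∈ portSeqs t) (sym (go≡portsDrivenBy-pebblesSeen P t r [] refl))
      (∈-map⁺ (portsDrivenBy t r [] refl) (∈-bitStrings (pebblesSeen P t r [] refl)))

mainTheorem2 : {n : ℕ} (G : PortGraph n) (r : Fin n) (A : Algorithm) (t : ℕ) → 1 ≤ t →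
    Σ (List (Vec ℕ t)) (λ L → (length L ≤ 2 ^ t) × ((P : Placement n) → portSeq G A r P t ∈ L))
mainTheorem2 G r A t _ =
  portSeqs t , ≤-reflexive (length-portSeqs t) , λ P → portSeq∈portSeqs P t
  where open BitDriven G A r
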